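{- If a Boolean function $f$ is computable by a (monotone) hypergraph program $H$ of degree $\le 2$, then it can also be computed by a (monotone) hypergraph program of degree $2$ and size $|H|+3$.
   Context: A hypergraph program (HGP) is a hypergraph $H=(V,E)$ ($E\subseteq 2^V$) in which every vertex is labelled with $0$, $1$, a variable $p_i$ or a negated variable $\neg p_i$. A set of hyperedges is independent if its members are pairwise disjoint. $H$ computes $f$ if for every input $\vec{\alpha}$, $f(\vec{\alpha})=1$ iff some independent set of hyperedges contains every vertex whose label evaluates to $0$ under $\vec{\alpha}$. It is monotone if there are no negated variables among labels. The size $|H|$ is the number of hyperedges. $H$ is of degree $\le n$ if every vertex belongs to at most $n$ hyperedges, and of degree $n$ if every vertex belongs to exactly $n$ hyperedges. -}

module Defs where

open import Data.Nat using (ℕ; _≤_; _+_)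
open import Data.Bool using (Bool; true; false; not)
open import Data.Fin using (Fin)
open import Data.Fin.Subset using (Subset; _∈_; ∣_∣)
open import Data.Vec using (lookup; tabulate)
open import Data.Product using (Σ; ∃; _×_)
open import Data.Empty using (⊥)
open import Data.Unit using (⊤)
open import Relation.Nullary using (¬_)
open import Relation.Binary.PropositionalEquality using (_≡_)
open import Function.Bundles using (_⇔_)

data Label (n : ℕ) : Set where
  lit0 lit1 : Label n
  pos neg   : Fin n → Label n

evalLabel : ∀ {n} → (Fin n → Bool) → Label n → Bool
evalLabel α lit0    = false
evalLabel α lit1    = true
evalLabel α (pos i) = α i
evalLabel α (neg i) = not (α i)

-- A hypergraph program: vertices Fin nV, hyperedges indexed by Fin nE.
-- E is a *set* of subsets of V, so the indexing is injective.
record HGP (n : ℕ) : Set where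
  field
    nV       : ℕ
    nE       : ℕ
    label    : Fin nV → Label n
    edge     : Fin nE → Subset nV
    distinct : ∀ i j → edge i ≡ edge j → i ≡ j
open HGP public

size : ∀ {n} → HGP n → ℕ
size H = nE H

degreeAt : ∀ {n} (H : HGP n) → Fin (nV H) → ℕ
degreeAt H x = ∣ tabulate (λ i → lookup (edge H i) x) ∣

DegreeLE : ∀ {n} → HGP n → ℕ → Set
DegreeLE H d = ∀ x → degreeAt H x ≤ d

DegreeEq : ∀ {n} → HGP n → ℕ → Set
DegreeEq H d = ∀ x → degreeAt H x ≡ d

Independent : ∀ {n} (H : HGP n) → Subset (nE H) → Set
Independent H S = ∀ i j → i ∈ S → j ∈ S → ¬ (i ≡ j) →
  ∀ x → x ∈ edge H i → x ∈ edge H j → ⊥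

Covers : ∀ {n} (H : HGP n) → (Fin n → Bool) → Subset (nE H) → Set
Covers H α S = ∀ x → evalLabel α (label H x) ≡ false →
  ∃ λ i → i ∈ S × x ∈ edge H i

Computes : ∀ {n} → HGP n → ((Fin n → Bool) → Bool) → Set
Computes H f = ∀ α → (f α ≡ true) ⇔ (∃ λ S → Independent H S × Covers H α S)

isNeg : ∀ {n} → Label n → Set
isNeg (neg _) = ⊤
isNeg _       = ⊥

Monotone : ∀ {n} → HGP n → Set
Monotone H = ∀ x → ¬ isNeg (label H x)

-- Add three vertices z, t (labelled 0) and u (labelled 1) and three hyperedges
-- A ⊇ {z, u}, B ⊇ {t, u}, C = {z, t}; A also takes every old vertex of degree < 2 and
-- B every old vertex of degree 0, so every vertex now has degree exactly 2. Only A and C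
-- contain z, only B and C contain t, and any two of A, B, C intersect; so an independent
-- cover contains C and neither A nor B, and it restricts to an independent cover of H.
-- Conversely every independent cover of H extends by C.
module Submission where

open import Defs
open import Data.Nat using (zero; suc; _+_; _<ᵇ_; _≡ᵇ_; _≤_; s≤s)
open import Data.Nat.Properties using (+-comm)
open import Data.Bool using (Bool)
open import Data.Fin using (Fin; zero; suc)
open import Data.Fin.Subset using (Subset; _∈_; _∉_; ∣_∣; inside; outside) renaming (⊥ to ∅)
open import Data.Fin.Subset.Properties using (∉⊥)
open import Data.Vec using (_∷_; lookup; tabulate; here; there)
open import Data.Vec.Properties using (lookup∘tabulate; lookup-replicate; ∷-injectiveʳ)
open import Data.Product using (∃; _×_; _,_)
open import Data.Empty using (⊥-elim)
open import Relation.Binary.PropositionalEquality using (_≡_; refl; cong)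
open import Function.Bundles using (mk⇔; Equivalence)

∣tabulate-outside∣ : ∀ m → ∣ tabulate {n = m} (λ _ → outside) ∣ ≡ 0
∣tabulate-outside∣ zero    = refl
∣tabulate-outside∣ (suc m) = ∣tabulate-outside∣ m

∣padding∣≡2 : ∀ {m} (v : Subset m) d → ∣ v ∣ ≡ d → d ≤ 2 →
              ∣ (d <ᵇ 2) ∷ (d ≡ᵇ 0) ∷ outside ∷ v ∣ ≡ 2
∣padding∣≡2 v 0 ∣v∣≡d _               = cong (λ k → suc (suc k)) ∣v∣≡d
∣padding∣≡2 v 1 ∣v∣≡d _               = cong suc ∣v∣≡d
∣padding∣≡2 v 2 ∣v∣≡d _               = ∣v∣≡d
∣padding∣≡2 v (suc (suc (suc _))) _ (s≤s (s≤s ()))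

pattern z = zero
pattern t = suc zero
pattern u = suc (suc zero)
pattern A = zero
pattern B = suc zero
pattern C = suc (suc zero)
pattern old x = suc (suc (suc x))
pattern there³ p = there (there (there p))

module Regularisation {n} (H : HGP n) where

  labelR : Fin (3 + nV H) → Label n
  labelR z       = lit0
  labelR t       = lit0
  labelR u       = lit1
  labelR (old x) = label H x

  edgeR : Fin (3 + nE H) → Subset (3 + nV H)
  edgeR A       = inside  ∷ outside ∷ inside  ∷ tabulate (λ x → degreeAt H x <ᵇ 2)
  edgeR B       = outside ∷ inside  ∷ inside  ∷ tabulate (λ x → degreeAt H x ≡ᵇ 0)
  edgeR C       = inside  ∷ inside  ∷ outside ∷ ∅
  edgeR (old e) = outside ∷ outside ∷ outside ∷ edge H e

  edgeR-injective : ∀ i j → edgeR i ≡ edgeR j → i ≡ j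
  edgeR-injective A A _ = refl
  edgeR-injective B B _ = refl
  edgeR-injective C C _ = refl
  edgeR-injective (old e) (old e′) eq =
    cong old (distinct H e e′ (∷-injectiveʳ (∷-injectiveʳ (∷-injectiveʳ eq))))
  edgeR-injective A B ()
  edgeR-injective A C ()
  edgeR-injective A (old _) ()
  edgeR-injective B A ()
  edgeR-injective B C ()
  edgeR-injective B (old _) ()
  edgeR-injective C A ()
  edgeR-injective C B ()
  edgeR-injective C (old _) ()
  edgeR-injective (old _) A ()
  edgeR-injective (old _) B ()
  edgeR-injective (old _) C ()

  regularise : HGP n
  regularise = record
    { nV = 3 + nV H ; nE = 3 + nE H ; label = labelR ; edge = edgeR ; distinct = edgeR-injective }

  regularise-degree : DegreeLE H 2 → DegreeEq regularise 2
  regularise-degree _ z = cong (2 +_) (∣tabulate-outside∣ (nE H))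
  regularise-degree _ t = cong (2 +_) (∣tabulate-outside∣ (nE H))
  regularise-degree _ u = cong (2 +_) (∣tabulate-outside∣ (nE H))
  regularise-degree deg≤2 (old x)
    rewrite lookup∘tabulate (λ y → degreeAt H y <ᵇ 2) x
          | lookup∘tabulate (λ y → degreeAt H y ≡ᵇ 0) x
          | lookup-replicate x outside
    = ∣padding∣≡2 (tabulate (λ e → lookup (edge H e) x)) _ refl (deg≤2 x)

  regularise-monotone : Monotone H → Monotone regularise
  regularise-monotone mono (old x) = mono x
  regularise-monotone _ z ()
  regularise-monotone _ t ()
  regularise-monotone _ u ()

  C∩old≡∅ : ∀ {e y} → y ∈ edgeR C → y ∉ edgeR (old e)
  C∩old≡∅ here         ()
  C∩old≡∅ (there here) (there ())
  C∩old≡∅ (there³ y∈∅) _ = ∉⊥ y∈∅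

  lift : Subset (nE H) → Subset (3 + nE H)
  lift S = outside ∷ outside ∷ inside ∷ S

  restrict : Subset (3 + nE H) → Subset (nE H)
  restrict (_ ∷ _ ∷ _ ∷ S) = S

  ∈restrict⁻ : ∀ {S′ e} → e ∈ restrict S′ → old e ∈ S′
  ∈restrict⁻ {_ ∷ _ ∷ _ ∷ _} e∈S = there³ e∈S

  lift-independent : ∀ {S} → Independent H S → Independent regularise (lift S)
  lift-independent _ A _ () _
  lift-independent _ B _ (there ()) _
  lift-independent _ _ A _ ()
  lift-independent _ _ B _ (there ())
  lift-independent _ C C _ _ C≢C = ⊥-elim (C≢C refl)
  lift-independent _ C (old e) _ _ _ _ y∈C y∈e = C∩old≡∅ y∈C y∈e
  lift-independent _ (old e) C _ _ _ _ y∈e y∈C = C∩old≡∅ y∈C y∈e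
  lift-independent ind (old e) (old e′) (there³ e∈S) (there³ e′∈S) e≢e′
                   (old x) (there³ x∈e) (there³ x∈e′) =
    ind e e′ e∈S e′∈S (λ { refl → e≢e′ refl }) x x∈e x∈e′

  lift-covers : ∀ {α S} → Covers H α S → Covers regularise α (lift S)
  lift-covers _ z _ = C , there (there here) , here
  lift-covers _ t _ = C , there (there here) , there here
  lift-covers _ u ()
  lift-covers cov (old x) x↦0 =
    let e , e∈S , x∈e = cov x x↦0 in old e , there³ e∈S , there³ x∈e

  restrict-independent : ∀ {S′} → Independent regularise S′ → Independent H (restrict S′)
  restrict-independent ind e e′ e∈S e′∈S e≢e′ x x∈e x∈e′ =
    ind (old e) (old e′) (∈restrict⁻ e∈S) (∈restrict⁻ e′∈S) (λ { refl → e≢e′ refl })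
        (old x) (there³ x∈e) (there³ x∈e′)

  module _ {α S′} (ind : Independent regularise S′) (cov : Covers regularise α S′) where

    A∉cover : A ∉ S′
    A∉cover A∈S′ with cov t refl
    ... | B , B∈S′ , _ =
      ind A B A∈S′ B∈S′ (λ ()) u (there (there here)) (there (there here))
    ... | C , C∈S′ , _ = ind A C A∈S′ C∈S′ (λ ()) z here here
    ... | A , _ , there ()
    ... | old _ , _ , there ()

    B∉cover : B ∉ S′
    B∉cover B∈S′ with cov z refl
    ... | A , A∈S′ , _ =
      ind B A B∈S′ A∈S′ (λ ()) u (there (there here)) (there (there here))
    ... | C , C∈S′ , _ = ind B C B∈S′ C∈S′ (λ ()) t (there here) (there here)
    ... | B , _ , ()
    ... | old _ , _ , ()

    restrict-covers : Covers H α (restrict S′)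
    restrict-covers x x↦0 with cov (old x) x↦0
    ... | A , A∈S′ , _ = ⊥-elim (A∉cover A∈S′)
    ... | B , B∈S′ , _ = ⊥-elim (B∉cover B∈S′)
    ... | C , _ , there³ x∈∅ = ⊥-elim (∉⊥ x∈∅)
    ... | old e , there³ e∈S , there³ x∈e = e , e∈S , x∈e

  regularise-computes : ∀ {f} → Computes H f → Computes regularise f
  regularise-computes H⊨f α = mk⇔
    (λ fα≡1 → let S , ind , cov = Equivalence.to (H⊨f α) fα≡1
              in lift S , lift-independent ind , lift-covers cov)
    (λ (S′ , ind , cov) →
       Equivalence.from (H⊨f α) (restrict S′ , restrict-independent ind , restrict-covers ind cov))

open Regularisation

lemma5 : ∀ {n} (f : (Fin n → Bool) → Bool) (H : HGP n) →
    DegreeLE H 2 → Computes H f →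
    ∃ λ (H′ : HGP n) → DegreeEq H′ 2 × size H′ ≡ size H + 3 × Computes H′ f ×
    (Monotone H → Monotone H′)
lemma5 f H deg≤2 H⊨f =
  regularise H , regularise-degree H deg≤2 , +-comm 3 (nE H) ,
  regularise-computes H H⊨f , regularise-monotone H
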